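{- There exists a positive integer $n_0$ such that $\mu_5(H_n)<\mu_5(G_n)$ for every integer $n\ge n_0$.
   Context: For a graph $G$, a $k$-edge-cut is a set $F$ of $k$ edges of $G$ such that $G-F$ is disconnected, and $\mu_k(G)$ is the number of $k$-edge-cuts of $G$. The Wagner graph $W$ has vertex set $\{1,\dots,8\}$ and edges labelled $e_1=15$, $e_2=37$, $e_3=26$, $e_4=48$, $e_5=12$, $e_6=67$, $e_7=34$, $e_8=81$, $e_9=56$, $e_{10}=45$, $e_{11}=78$, $e_{12}=23$. For positive integers $\ell_1,\dots,\ell_{12}$, $W(\ell_1,\dots,\ell_{12})$ is the graph obtained from $W$ by subdividing the edge $e_i$ exactly $\ell_i-1$ times (i.e. replacing $e_i$ by a path with $\ell_i$ edges whose internal vertices are new vertices of degree $2$), for each $i$. For an integer $n\ge 8$, let $r,s$ be the unique integers with $n+4=12s+r$ and $r\in\{0,\dots,11\}$; let $X_0=\emptyset$, $X_8=\{e_1,e_2,e_3,e_4,e_6,e_8,e_{10},e_{12}\}$, and $X_r=\{e_1,\dots,e_r\}$ for $r\notin\{0,8\}$; let $\ell_i=s+1$ if $e_i\in X_r$ and $\ell_i=s$ otherwise; and let $G_n=W(\ell_1,\dots,\ell_{12})$ (a graph with $n$ vertices and $n+4$ edges). Whenever $\ell_5\ge 2$ (in particular for all $n\ge 17$), let $H_n=W(\ell_1',\dots,\ell_{12}')$ where $\ell_1'=\ell_1+1$, $\ell_5'=\ell_5-1$ and $\ell_i'=\ell_i$ for $i\notin\{1,5\}$. -}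

module Defs where

open import Data.Nat using (ℕ; zero; suc; _+_; _∸_; _<_; _≤_; _≡ᵇ_)
open import Data.Nat.DivMod using (_/_; _%_)
open import Data.Bool using (Bool; true; false; if_then_else_)
open import Data.Fin using (Fin; toℕ)
open import Data.Fin.Subset using (Subset; _∉_; ∣_∣)
open import Data.List using (List; []; _∷_; _++_; length; lookup)
open import Data.Vec using (Vec; []; _∷_; updateAt; toList; zip; tabulate)
import Data.Vec as V
open import Data.Product using (Σ; ∃; _×_; _,_)
open import Data.Sum using (_⊎_)
open import Relation.Nullary using (¬_)
open import Relation.Binary.PropositionalEquality using (_≡_)
open import Function.Definitions using (Injective)

-- Finite multigraphs: vertices 0 … nv-1 (natural numbers), edges are a
-- list of unordered pairs of vertices (edge i = i-th list entry).

record Graph : Set where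
  constructor mkGraph
  field
    nv    : ℕ
    edges : List (ℕ × ℕ)

  ne : ℕ
  ne = length edges

  edge : Fin ne → ℕ × ℕ
  edge = lookup edges

open Graph public

Adj : (G : Graph) → Subset (ne G) → ℕ → ℕ → Set
Adj G F u v = ∃ λ (i : Fin (ne G)) → i ∉ F × (edge G i ≡ (u , v) ⊎ edge G i ≡ (v , u))

data Reach (G : Graph) (F : Subset (ne G)) : ℕ → ℕ → Set where
  here : ∀ {u} → Reach G F u u
  step : ∀ {u v w} → Adj G F u v → Reach G F v w → Reach G F u w

Disconnected- : (G : Graph) → Subset (ne G) → Set
Disconnected- G F = ∃ λ (u : Fin (nv G)) → ∃ λ (v : Fin (nv G)) → ¬ Reach G F (toℕ u) (toℕ v)

IsEdgeCut : ℕ → (G : Graph) → Subset (ne G) → Set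
IsEdgeCut k G F = ∣ F ∣ ≡ k × Disconnected- G F

-- μ_k(G) = N : the k-edge-cuts of G are enumerated without repetition
-- by Fin N
IsMu : ℕ → Graph → ℕ → Set
IsMu k G N =
  Σ (Fin N → Subset (ne G)) λ f →
    Injective _≡_ _≡_ f
    × (∀ x → IsEdgeCut k G (f x))
    × (∀ F → IsEdgeCut k G F → ∃ λ x → f x ≡ F)

-- Subdivisions of the Wagner graph.  Vertex j of W is encoded as j-1.

-- path a b ℓ c : a path from a to b with ℓ edges whose internal vertices
-- are the fresh vertices c, c+1, …, c+ℓ-2
path : ℕ → ℕ → ℕ → ℕ → List (ℕ × ℕ)
path a b zero c = []
path a b (suc zero) c = (a , b) ∷ []
path a b (suc (suc k)) c = (a , c) ∷ path c b (suc k) (suc c)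

subdivEdges : List ((ℕ × ℕ) × ℕ) → ℕ → List (ℕ × ℕ)
subdivEdges [] c = []
subdivEdges (((a , b) , ℓ) ∷ es) c = path a b ℓ c ++ subdivEdges es (c + (ℓ ∸ 1))

sumPred : List ((ℕ × ℕ) × ℕ) → ℕ
sumPred [] = 0
sumPred ((_ , ℓ) ∷ es) = (ℓ ∸ 1) + sumPred es

-- edges e1 … e12 of W (vertex j ↦ j-1)
wagnerEdges : Vec (ℕ × ℕ) 12
wagnerEdges =
  (0 , 4) ∷ (2 , 6) ∷ (1 , 5) ∷ (3 , 7) ∷ (0 , 1) ∷ (5 , 6) ∷
  (2 , 3) ∷ (7 , 0) ∷ (4 , 5) ∷ (3 , 4) ∷ (6 , 7) ∷ (1 , 2) ∷ []

-- W(ℓ1,…,ℓ12); index 0 of the vector is ℓ1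
W : Vec ℕ 12 → Graph
W ℓ = mkGraph (8 + sumPred es) (subdivEdges es 8)
  where es = toList (zip wagnerEdges ℓ)

-- membership of e_{j+1} in X_r
inX : ℕ → ℕ → Bool
inX r j = if r ≡ᵇ 8 then inX8 j else ltb j r
  where
  ltb : ℕ → ℕ → Bool
  ltb _ zero = false
  ltb zero (suc _) = true
  ltb (suc a) (suc b) = ltb a b
  inX8 : ℕ → Bool
  inX8 0 = true
  inX8 1 = true
  inX8 2 = true
  inX8 3 = true
  inX8 5 = true
  inX8 7 = true
  inX8 9 = true
  inX8 11 = true
  inX8 _ = false

sOf rOf : ℕ → ℕ
sOf n = (n + 4) / 12
rOf n = (n + 4) % 12

ℓG : ℕ → Vec ℕ 12
ℓG n = tabulate λ j → if inX (rOf n) (toℕ j) then suc (sOf n) else sOf n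

ℓH : ℕ → Vec ℕ 12
ℓH n = updateAt (ℓG n) (Data.Fin.suc (Data.Fin.suc (Data.Fin.suc (Data.Fin.suc Data.Fin.zero)))) (λ x → x ∸ 1)
       |> λ v → updateAt v Data.Fin.zero suc
  where
  _|>_ : ∀ {A B : Set} → A → (A → B) → B
  x |> f = f x

ℓ5 : ℕ → ℕ
ℓ5 n = V.lookup (ℓG n) (Data.Fin.suc (Data.Fin.suc (Data.Fin.suc (Data.Fin.suc Data.Fin.zero))))

Gn Hn : ℕ → Graph
Gn n = W (ℓG n)
Hn n = W (ℓH n)

-- Removing a set F of edges from the subdivision W(ℓ) leaves it connected iff
-- F meets every subdivided edge (a path of length ℓᵢ) at most once and the
-- edges of W it meets form a non-cut S of W: inner vertices then hang on a path
-- end, and otherwise a closed labelling of the vertices separates two of them.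
-- So the connected deletions of 5 edges number Σ_S ∏_{i ∈ S} ℓᵢ over the
-- 5-sets S of edges of W with W - S connected, and μ₅ is the number of 5-sets
-- of edges minus this sum. G_n and H_n have equally many edges, so it suffices
-- that the sum is larger for H_n. With n + 4 = 12s + r and s = 15 + t, both
-- sums are polynomials in t for each residue r, and the one for H_n is larger
-- in the constant and no smaller in any other coefficient. These finitely many
-- facts, and the connectivity of W minus each set of edges, are checked by
-- evaluation.

module Submission where

open import Algebra.Properties.CommutativeSemigroup using (interchange)
open import Data.Bool using (Bool; true; false; not; _∧_; _∨_; if_then_else_; T)
import Data.Bool as Bool
open import Data.Bool.Properties using (T-∧; T-≡; ∧-zeroʳ; ∨-identityʳ)
open import Data.Empty using (⊥-elim)
open import Data.Fin using (Fin; zero; suc; toℕ; fromℕ<; #_; splitAt; join)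
open import Data.Fin.Properties using (toℕ<n; toℕ-fromℕ<; splitAt-join; join-splitAt; all?; ¬∀⟶∃¬)
open import Data.Fin.Subset using (Subset; ∣_∣; _∉_)
open import Data.Fin.Subset.Properties using (∣p∣≤n; ∣p∣≤∣x∷p∣; anySubset?)
open import Data.List using (List; []; _∷_; _++_; length)
import Data.List as List
open import Data.List.Properties using (length-++)
open import Data.List.Relation.Binary.Pointwise using (Pointwise; []; _∷_)
open import Data.List.Relation.Binary.Pointwise.Properties using (decidable)
open import Data.Nat using (ℕ; zero; suc; _+_; _*_; _∸_; _≤_; _<_; z≤n; s≤s; z<s; _≡ᵇ_; _≤ᵇ_; _<ᵇ_; _≟_; _≤?_; _<?_)
open import Data.Nat.DivMod using (m%n<n; /-monoˡ-≤)
open import Data.Nat.Properties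
open import Data.Nat.Tactic.RingSolver using (solve-∀)
open import Data.Product using (Σ; ∃; _×_; _,_; proj₁; proj₂)
open import Data.Sum using (_⊎_; inj₁; inj₂; [_,_])
open import Data.Vec using (Vec; []; _∷_; here; there; tail; toList; zip; map; sum; tabulate; updateAt; lookup)
open import Data.Vec.Properties using (tabulate-cong; tabulate-∘; map-updateAt)
import Data.Vec.Relation.Unary.All as All
open import Data.Vec.Relation.Unary.All using (All; []; _∷_)
open import Data.Vec.Relation.Unary.All.Properties using (map⁺)
open import Function using (_∘_; _⇔_; mk⇔; Equivalence; Injective; case_of_)
open import Relation.Binary.Construct.Closure.ReflexiveTransitive as Star using (Star; ε; _◅_; _◅◅_; _⋆)
open import Relation.Binary.PropositionalEquality using (_≡_; _≢_; refl; sym; trans; cong; cong₂; subst; subst₂; module ≡-Reasoning)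
open import Relation.Nullary using (Dec; ¬_; contradiction; does; isYes; yes; no; ¬?)
import Relation.Nullary.Decidable as Dec
open import Relation.Nullary.Decidable using (T?; toWitness; fromWitness; toWitnessFalse; decidable-stable; from-yes; dec-true; dec-false; _×-dec_)

open import Defs

-- Counting Boolean vectors

count : (k : ℕ) → (Vec Bool k → Bool) → ℕ
count zero    p = if p [] then 1 else 0
count (suc k) p = count k (p ∘ (true ∷_)) + count k (p ∘ (false ∷_))

count-cong : ∀ k {p q : Vec Bool k → Bool} → (∀ v → p v ≡ q v) → count k p ≡ count k q
count-cong zero    p≗q = cong (λ b → if b then 1 else 0) (p≗q [])
count-cong (suc k) p≗q = cong₂ _+_ (count-cong k (p≗q ∘ (true ∷_))) (count-cong k (p≗q ∘ (false ∷_)))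

count-false : ∀ k → count k (λ _ → false) ≡ 0
count-false zero    = refl
count-false (suc k) = cong₂ _+_ (count-false k) (count-false k)

count-∨ : ∀ k {p q : Vec Bool k → Bool} → (∀ v → p v ∧ q v ≡ false) →
          count k (λ v → p v ∨ q v) ≡ count k p + count k q
count-∨ zero {p} {q} disjoint with p [] | q [] | disjoint []
... | true  | true  | ()
... | true  | false | _ = refl
... | false | _     | _ = refl
count-∨ (suc k) {p} {q} disjoint =
  trans (cong₂ _+_ (count-∨ k (disjoint ∘ (true ∷_))) (count-∨ k (disjoint ∘ (false ∷_))))
        (interchange +-commutativeSemigroup (count k (p ∘ (true ∷_))) (count k (q ∘ (true ∷_)))
                                            (count k (p ∘ (false ∷_))) (count k (q ∘ (false ∷_))))

count-∧-not : ∀ k (p q : Vec Bool k → Bool) →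
              count k (λ v → p v ∧ q v) + count k (λ v → p v ∧ not (q v)) ≡ count k p
count-∧-not k p q = trans (sym (count-∨ k (λ v → disjoint (p v) (q v)))) (count-cong k (λ v → cover (p v) (q v)))
  where
  disjoint : ∀ x y → (x ∧ y) ∧ (x ∧ not y) ≡ false
  disjoint true  true  = refl
  disjoint true  false = refl
  disjoint false _     = refl
  cover : ∀ x y → (x ∧ y) ∨ (x ∧ not y) ≡ x
  cover true  true  = refl
  cover true  false = refl
  cover false _     = refl

count-none : ∀ k → count k (λ v → ∣ v ∣ ≡ᵇ 0) ≡ 1
count-none zero    = refl
count-none (suc k) = cong₂ _+_ (count-false k) (count-none k)

count-single : ∀ k → count k (λ v → ∣ v ∣ ≡ᵇ 1) ≡ k
count-single zero    = refl
count-single (suc k) = cong₂ _+_ (count-none k) (count-single k)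

module _ {A : Set} where

  maskˡ : ∀ (ys : List A) {zs} → Vec Bool (length (ys ++ zs)) → Vec Bool (length ys)
  maskˡ []       F       = []
  maskˡ (_ ∷ ys) (b ∷ F) = b ∷ maskˡ ys F

  maskʳ : ∀ (ys : List A) {zs} → Vec Bool (length (ys ++ zs)) → Vec Bool (length zs)
  maskʳ []       F       = F
  maskʳ (_ ∷ ys) (_ ∷ F) = maskʳ ys F

  count-++ : ∀ (ys zs : List A) (p : Vec Bool (length ys) → Bool) (q : Vec Bool (length zs) → Bool) →
             count (length (ys ++ zs)) (λ F → p (maskˡ ys F) ∧ q (maskʳ ys F))
               ≡ count (length ys) p * count (length zs) q
  count-++ []       zs p q with p []
  ... | true  = sym (+-identityʳ _)
  ... | false = count-false (length zs)
  count-++ (_ ∷ ys) zs p q =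
    trans (cong₂ _+_ (count-++ ys zs (p ∘ (true ∷_)) q) (count-++ ys zs (p ∘ (false ∷_)) q))
          (sym (*-distribʳ-+ (count (length zs) q) (count (length ys) (p ∘ (true ∷_))) (count (length ys) (p ∘ (false ∷_)))))

∣∣-++ : ∀ {A : Set} (ys : List A) {zs} (F : Vec Bool (length (ys ++ zs))) →
        ∣ F ∣ ≡ ∣ maskˡ ys F ∣ + ∣ maskʳ ys F ∣
∣∣-++ []       F           = refl
∣∣-++ (_ ∷ ys) (true ∷ F)  = cong suc (∣∣-++ ys F)
∣∣-++ (_ ∷ ys) (false ∷ F) = ∣∣-++ ys F

-- IsMu k G N unfolds to Enumerates (IsEdgeCut k G) N.
Enumerates : ∀ {k} → (Vec Bool k → Set) → ℕ → Set
Enumerates {k} P N =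
  Σ (Fin N → Vec Bool k) λ f → Injective _≡_ _≡_ f × (∀ x → P (f x)) × (∀ v → P v → ∃ λ x → f x ≡ v)

Enumerates-⇔ : ∀ {k} {P Q : Vec Bool k → Set} {N} → (∀ v → P v ⇔ Q v) → Enumerates P N → Enumerates Q N
Enumerates-⇔ P⇔Q (f , f-injective , f-sound , f-complete) =
  f , f-injective , (λ x → to (P⇔Q (f x)) (f-sound x)) , (λ v → f-complete v ∘ from (P⇔Q v))
  where open Equivalence

Enumerates-∷ : ∀ {k} {P : Vec Bool (suc k) → Set} {A B} →
               Enumerates (P ∘ (true ∷_)) A → Enumerates (P ∘ (false ∷_)) B → Enumerates P (A + B)
Enumerates-∷ {k} {P} {A} {B} (f₁ , f₁-injective , f₁-sound , f₁-complete)
                             (f₂ , f₂-injective , f₂-sound , f₂-complete) =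
  f , f-injective , f-sound , f-complete
  where
  g : Fin A ⊎ Fin B → Vec Bool (suc k)
  g = [ (true ∷_) ∘ f₁ , (false ∷_) ∘ f₂ ]
  f : Fin (A + B) → Vec Bool (suc k)
  f = g ∘ splitAt A
  g-injective : Injective _≡_ _≡_ g
  g-injective {inj₁ i} {inj₁ j} eq = cong inj₁ (f₁-injective (cong tail eq))
  g-injective {inj₂ i} {inj₂ j} eq = cong inj₂ (f₂-injective (cong tail eq))
  g-injective {inj₁ i} {inj₂ j} ()
  g-injective {inj₂ i} {inj₁ j} ()
  f-injective : Injective _≡_ _≡_ f
  f-injective {x} {y} fx≡fy = begin
    x                       ≡⟨ join-splitAt A B x ⟨
    join A B (splitAt A x)  ≡⟨ cong (join A B) (g-injective {splitAt A x} {splitAt A y} fx≡fy) ⟩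
    join A B (splitAt A y)  ≡⟨ join-splitAt A B y ⟩
    y                       ∎
    where open ≡-Reasoning
  f-sound : ∀ x → P (f x)
  f-sound x with splitAt A x
  ... | inj₁ i = f₁-sound i
  ... | inj₂ i = f₂-sound i
  f-complete : ∀ v → P v → ∃ λ x → f x ≡ v
  f-complete (true ∷ v) Pv with f₁-complete v Pv
  ... | i , refl = join A B (inj₁ i) , cong g (splitAt-join A B (inj₁ i))
  f-complete (false ∷ v) Pv with f₂-complete v Pv
  ... | i , refl = join A B (inj₂ i) , cong g (splitAt-join A B (inj₂ i))

enumerate : ∀ k (p : Vec Bool k → Bool) → Enumerates (T ∘ p) (count k p)
enumerate zero p with p [] in p[]
... | true  = (λ _ → []) , (λ { {zero} {zero} _ → refl }) , (λ _ → subst T (sym p[]) _) , (λ { [] _ → zero , refl })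
... | false = (λ ()) , (λ { {()} }) , (λ ()) , (λ { [] p[]-holds → ⊥-elim (subst T p[] p[]-holds) })
enumerate (suc k) p = Enumerates-∷ (enumerate k (p ∘ (true ∷_))) (enumerate k (p ∘ (false ∷_)))

-- Walks avoiding removed edges

-- F marks removed edges; edges of es beyond the length of F count as absent.
data Link : List (ℕ × ℕ) → ∀ {n} → Vec Bool n → ℕ → ℕ → Set where
  forward  : ∀ {u v es n r} {F : Vec Bool n} → r ≡ false → Link ((u , v) ∷ es) (r ∷ F) u v
  backward : ∀ {u v es n r} {F : Vec Bool n} → r ≡ false → Link ((u , v) ∷ es) (r ∷ F) v u
  later    : ∀ {e u v es n r} {F : Vec Bool n} → Link es F u v → Link (e ∷ es) (r ∷ F) u v

Walk : List (ℕ × ℕ) → ∀ {n} → Vec Bool n → ℕ → ℕ → Set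
Walk es F = Star (Link es F)

Link-sym : ∀ {es n} {F : Vec Bool n} {u v} → Link es F u v → Link es F v u
Link-sym (forward r≡false)  = backward r≡false
Link-sym (backward r≡false) = forward r≡false
Link-sym (later link)       = later (Link-sym link)

Walk-sym : ∀ {es n} {F : Vec Bool n} {u v} → Walk es F u v → Walk es F v u
Walk-sym = Star.reverse Link-sym

Closed : (ℕ → Bool) → List (ℕ × ℕ) → ∀ {n} → Vec Bool n → Set
Closed P es F = ∀ {u v} → Link es F u v → P u ≡ P v

Walk-preserves : ∀ {P es n} {F : Vec Bool n} → Closed P es F → ∀ {u v} → Walk es F u v → P u ≡ P v
Walk-preserves {P} closed = Star.fold (λ u v → P u ≡ P v) (λ link eq → trans (closed link) eq) refl

module _ {u v : ℕ} where

  Link-++ˡ : ∀ ys {zs} {F : Vec Bool (length (ys ++ zs))} → Link ys (maskˡ ys F) u v → Link (ys ++ zs) F u v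
  Link-++ˡ (_ ∷ ys) {F = _ ∷ F} (forward r≡false)  = forward r≡false
  Link-++ˡ (_ ∷ ys) {F = _ ∷ F} (backward r≡false) = backward r≡false
  Link-++ˡ (_ ∷ ys) {F = _ ∷ F} (later link)       = later (Link-++ˡ ys link)

  Link-++ʳ : ∀ ys {zs} {F : Vec Bool (length (ys ++ zs))} → Link zs (maskʳ ys F) u v → Link (ys ++ zs) F u v
  Link-++ʳ []       link = link
  Link-++ʳ (_ ∷ ys) {F = _ ∷ F} link = later (Link-++ʳ ys link)

  Link-++⁻ : ∀ ys {zs} {F : Vec Bool (length (ys ++ zs))} →
             Link (ys ++ zs) F u v → Link ys (maskˡ ys F) u v ⊎ Link zs (maskʳ ys F) u v
  Link-++⁻ []       link                          = inj₂ link
  Link-++⁻ (_ ∷ ys) {F = _ ∷ F} (forward r≡false)  = inj₁ (forward r≡false)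
  Link-++⁻ (_ ∷ ys) {F = _ ∷ F} (backward r≡false) = inj₁ (backward r≡false)
  Link-++⁻ (_ ∷ ys) {F = _ ∷ F} (later link) with Link-++⁻ ys link
  ... | inj₁ linkˡ = inj₁ (later linkˡ)
  ... | inj₂ linkʳ = inj₂ linkʳ

Closed-++ : ∀ {P} ys {zs} {F : Vec Bool (length (ys ++ zs))} →
            Closed P ys (maskˡ ys F) → Closed P zs (maskʳ ys F) → Closed P (ys ++ zs) F
Closed-++ ys closedˡ closedʳ link with Link-++⁻ ys link
... | inj₁ linkˡ = closedˡ linkˡ
... | inj₂ linkʳ = closedʳ linkʳ

module _ {u v : ℕ} where

  Link⇒index : ∀ es {F : Vec Bool (length es)} → Link es F u v →
               ∃ λ (i : Fin (length es)) → i ∉ F × (List.lookup es i ≡ (u , v) ⊎ List.lookup es i ≡ (v , u))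
  Link⇒index (_ ∷ es) {false ∷ F} (forward refl)  = zero , (λ ()) , inj₁ refl
  Link⇒index (_ ∷ es) {false ∷ F} (backward refl) = zero , (λ ()) , inj₂ refl
  Link⇒index (_ ∷ es) {_ ∷ F}     (later link) with Link⇒index es link
  ... | i , i∉F , edge-i = suc i , (λ { (there i∈F) → i∉F i∈F }) , edge-i

  index⇒Link : ∀ es {F : Vec Bool (length es)} (i : Fin (length es)) → i ∉ F →
               (List.lookup es i ≡ (u , v) ⊎ List.lookup es i ≡ (v , u)) → Link es F u v
  index⇒Link (_ ∷ es) {true ∷ F}  zero    i∉F _            = contradiction here i∉F
  index⇒Link (_ ∷ es) {false ∷ F} zero    i∉F (inj₁ refl)  = forward refl
  index⇒Link (_ ∷ es) {false ∷ F} zero    i∉F (inj₂ refl)  = backward refl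
  index⇒Link (_ ∷ es) {_ ∷ F}     (suc i) i∉F edge-i       = later (index⇒Link es i (i∉F ∘ there) edge-i)

Reach⇔Walk : ∀ G {F : Subset (ne G)} {u v} → Reach G F u v ⇔ Walk (edges G) F u v
Reach⇔Walk G {F} = mk⇔ to from
  where
  to : ∀ {u v} → Reach G F u v → Walk (edges G) F u v
  to here                             = ε
  to (step (i , i∉F , edge-i) reach) = index⇒Link (edges G) i i∉F edge-i ◅ to reach
  from : ∀ {u v} → Walk (edges G) F u v → Reach G F u v
  from ε             = here
  from (link ◅ walk) = step (Link⇒index (edges G) link) (from walk)

-- Subdivided edges

length-path : ∀ a b l c → length (path a b l c) ≡ l
length-path a b zero          c = refl
length-path a b (suc zero)    c = refl
length-path a b (suc (suc l)) c = cong suc (length-path c b (suc l) (suc c))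

path-walk : ∀ a b l c (F : Vec Bool (length (path a b l c))) → 1 ≤ l → ∣ F ∣ ≡ 0 → Walk (path a b l c) F a b
path-walk a b (suc zero)    c (false ∷ []) _ _ = forward refl ◅ ε
path-walk a b (suc (suc l)) c (false ∷ F)  _ F-empty =
  forward refl ◅ Star.map later (path-walk c b (suc l) (suc c) F (s≤s z≤n) F-empty)

path-first-vertex : ∀ a b l c r (F : Vec Bool (length (path c b (suc l) (suc c)))) → ∣ r ∷ F ∣ ≤ 1 →
                    Walk (path a b (suc (suc l)) c) (r ∷ F) c a ⊎ Walk (path a b (suc (suc l)) c) (r ∷ F) c b
path-first-vertex a b l c false F _             = inj₁ (backward refl ◅ ε)
path-first-vertex a b l c true  F (s≤s ∣F∣≤0) =
  inj₂ (Star.map later (path-walk c b (suc l) (suc c) F (s≤s z≤n) (n≤0⇒n≡0 ∣F∣≤0)))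

path-internal-reaches-end : ∀ a b l c (F : Vec Bool (length (path a b l c))) → ∣ F ∣ ≤ 1 →
                            ∀ {x} → c ≤ x → x < c + (l ∸ 1) →
                            Walk (path a b l c) F x a ⊎ Walk (path a b l c) F x b
path-internal-reaches-end a b zero       c F _ c≤x x<c+0 = contradiction c≤x (<⇒≱ (subst (_ <_) (+-identityʳ c) x<c+0))
path-internal-reaches-end a b (suc zero) c F _ c≤x x<c+0 = contradiction c≤x (<⇒≱ (subst (_ <_) (+-identityʳ c) x<c+0))
path-internal-reaches-end a b (suc (suc l)) c (r ∷ F) ∣F∣≤1 {x} c≤x x<end with m≤n⇒m<n∨m≡n c≤x
... | inj₂ refl = path-first-vertex a b l c r F ∣F∣≤1
... | inj₁ c<x with path-internal-reaches-end c b (suc l) (suc c) F (≤-trans (∣p∣≤∣x∷p∣ r F) ∣F∣≤1)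
                                                c<x (subst (x <_) (+-suc c l) x<end)
...   | inj₂ to-b = inj₂ (Star.map later to-b)
...   | inj₁ to-c with path-first-vertex a b l c r F ∣F∣≤1
...     | inj₁ c-to-a = inj₁ (Star.map later to-c ◅◅ c-to-a)
...     | inj₂ c-to-b = inj₂ (Star.map later to-c ◅◅ c-to-b)

prefixCount : ℕ → ∀ {n} → Vec Bool n → ℕ
prefixCount zero    F           = 0
prefixCount (suc j) []          = 0
prefixCount (suc j) (true ∷ F)  = suc (prefixCount j F)
prefixCount (suc j) (false ∷ F) = prefixCount j F

module _ (P : ℕ → Bool) {g : ℕ → Bool} {c l : ℕ} (P≡g : ∀ j → suc j < suc (suc l) → P (c + j) ≡ g j) where

  first-internal-label : P c ≡ g 0
  first-internal-label = subst (λ x → P x ≡ g 0) (+-identityʳ c) (P≡g 0 (s≤s (s≤s z≤n)))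

  later-internal-labels : ∀ j → suc j < suc l → P (suc c + j) ≡ g (suc j)
  later-internal-labels j j<l = subst (λ x → P x ≡ g (suc j)) (+-suc c j) (P≡g (suc j) (s≤s j<l))

-- The inner vertex c + j comes after the first j + 1 edges of the path.
path-closed : ∀ P (f : ℕ → Bool) a b l c (F : Vec Bool (length (path a b l c))) →
              P a ≡ f 0 → P b ≡ f ∣ F ∣ → (∀ j → suc j < l → P (c + j) ≡ f (prefixCount (suc j) F)) →
              Closed P (path a b l c) F
path-closed P f a b (suc zero) c (_ ∷ []) Pa Pb _ (forward refl)  = trans Pa (sym Pb)
path-closed P f a b (suc zero) c (_ ∷ []) Pa Pb _ (backward refl) = trans Pb (sym Pa)
path-closed P f a b (suc (suc l)) c (false ∷ F) Pa Pb Pc (forward refl)  = trans Pa (sym (first-internal-label P Pc))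
path-closed P f a b (suc (suc l)) c (false ∷ F) Pa Pb Pc (backward refl) = trans (first-internal-label P Pc) (sym Pa)
path-closed P f a b (suc (suc l)) c (false ∷ F) Pa Pb Pc (later link) =
  path-closed P f c b (suc l) (suc c) F (first-internal-label P Pc) Pb (later-internal-labels P Pc) link
path-closed P f a b (suc (suc l)) c (true ∷ F) Pa Pb Pc (later link) =
  path-closed P (f ∘ suc) c b (suc l) (suc c) F (first-internal-label P Pc) Pb (later-internal-labels P Pc) link

-- Subdivisions of a graph

subdivision : ∀ {k} → Vec (ℕ × ℕ) k → Vec ℕ k → ℕ → List (ℕ × ℕ)
subdivision es ℓ c = subdivEdges (toList (zip es ℓ)) c

Mask : ∀ {k} → Vec (ℕ × ℕ) k → Vec ℕ k → ℕ → Set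
Mask es ℓ c = Vec Bool (length (subdivision es ℓ c))

support : ∀ {k} (es : Vec (ℕ × ℕ) k) ℓ c → Mask es ℓ c → Vec Bool k
support []             []      c F = []
support ((a , b) ∷ es) (l ∷ ℓ) c F =
  (0 <ᵇ ∣ maskˡ (path a b l c) F ∣) ∷ support es ℓ (c + (l ∸ 1)) (maskʳ (path a b l c) F)

atMostOnePerPath : ∀ {k} (es : Vec (ℕ × ℕ) k) ℓ c → Mask es ℓ c → Bool
atMostOnePerPath []             []      c F = true
atMostOnePerPath ((a , b) ∷ es) (l ∷ ℓ) c F =
  (∣ maskˡ (path a b l c) F ∣ ≤ᵇ 1) ∧ atMostOnePerPath es ℓ (c + (l ∸ 1)) (maskʳ (path a b l c) F)

0≮ᵇ⇒≡0 : ∀ {n} → (0 <ᵇ n) ≡ false → n ≡ 0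
0≮ᵇ⇒≡0 {zero} _ = refl

Link-lift : ∀ {k} (es : Vec (ℕ × ℕ) k) {ℓ} c {F : Mask es ℓ c} → All (0 <_) ℓ →
            ∀ {u v} → Link (toList es) (support es ℓ c F) u v → Walk (subdivision es ℓ c) F u v
Link-lift ((a , b) ∷ es) {l ∷ ℓ} c (0<l ∷ _) (forward kept) =
  Star.map (Link-++ˡ (path a b l c)) (path-walk a b l c _ 0<l (0≮ᵇ⇒≡0 kept))
Link-lift ((a , b) ∷ es) {l ∷ ℓ} c (0<l ∷ _) (backward kept) =
  Walk-sym (Star.map (Link-++ˡ (path a b l c)) (path-walk a b l c _ 0<l (0≮ᵇ⇒≡0 kept)))
Link-lift ((a , b) ∷ es) {l ∷ ℓ} c (_ ∷ positive) (later link) =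
  Star.map (Link-++ʳ (path a b l c)) (Link-lift es (c + (l ∸ 1)) positive link)

Walk-lift : ∀ {k} (es : Vec (ℕ × ℕ) k) {ℓ} c {F : Mask es ℓ c} → All (0 <_) ℓ →
            ∀ {u v} → Walk (toList es) (support es ℓ c F) u v → Walk (subdivision es ℓ c) F u v
Walk-lift es c positive = (Link-lift es c positive) ⋆

Below : ℕ → ℕ × ℕ → Set
Below m (a , b) = a < m × b < m

internalCount : ∀ {k} → Vec (ℕ × ℕ) k → Vec ℕ k → ℕ
internalCount es ℓ = sumPred (toList (zip es ℓ))

internal-reaches-base : ∀ {m k} (es : Vec (ℕ × ℕ) k) ℓ c (F : Mask es ℓ c) → All (Below m) es →
                        T (atMostOnePerPath es ℓ c F) → ∀ {x} → c ≤ x → x < c + internalCount es ℓ →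
                        ∃ λ o → o < m × Walk (subdivision es ℓ c) F x o
internal-reaches-base [] [] c F [] _ c≤x x<c+0 = contradiction c≤x (<⇒≱ (subst (_ <_) (+-identityʳ c) x<c+0))
internal-reaches-base ((a , b) ∷ es) (l ∷ ℓ) c F ((a<m , b<m) ∷ below) sparse {x} c≤x x<end
  with Equivalence.to T-∧ sparse | x <? c + (l ∸ 1)
... | ∣F₁∣≤1 , _ | yes x<c′ =
  [ (λ to-a → a , a<m , Star.map (Link-++ˡ (path a b l c)) to-a) ,
    (λ to-b → b , b<m , Star.map (Link-++ˡ (path a b l c)) to-b) ]
  (path-internal-reaches-end a b l c (maskˡ (path a b l c) F) (≤ᵇ⇒≤ _ 1 ∣F₁∣≤1) c≤x x<c′)
... | _ , sparse′ | no x≮c′ =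
  let o , o<m , to-o = internal-reaches-base es ℓ (c + (l ∸ 1)) (maskʳ (path a b l c) F) below sparse′
                         (≮⇒≥ x≮c′) (subst (x <_) (sym (+-assoc c (l ∸ 1) _)) x<end)
  in o , o<m , Star.map (Link-++ʳ (path a b l c)) to-o

-- The label of a vertex between removed edges of one path: the labels of
-- the path's ends on the two outer segments, true on the inner ones.
segmentLabel : Bool → Bool → ℕ → ℕ → Bool
segmentLabel x y R s = if s ≡ᵇ 0 then x else if s ≡ᵇ R then y else true

segmentLabel-end : ∀ {x y} R → (R ≡ 0 → x ≡ y) → segmentLabel x y R R ≡ y
segmentLabel-end zero    x≡y = x≡y refl
segmentLabel-end (suc R) _   rewrite Equivalence.to T-≡ (≡⇒≡ᵇ R R refl) = refl

segmentLabel-inner : ∀ {x y R} → 2 ≤ R → T (segmentLabel x y R 1)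
segmentLabel-inner (s≤s (s≤s _)) = _

extend : (ℕ → Bool) → ∀ {k} (es : Vec (ℕ × ℕ) k) ℓ c → Mask es ℓ c → ℕ → Bool
extend C []             []      c F x = C x
extend C ((a , b) ∷ es) (l ∷ ℓ) c F x =
  if does (c ≤? x ×-dec x <? c + (l ∸ 1))
  then segmentLabel (C a) (C b) ∣ maskˡ (path a b l c) F ∣ (prefixCount (suc (x ∸ c)) (maskˡ (path a b l c) F))
  else extend C es ℓ (c + (l ∸ 1)) (maskʳ (path a b l c) F) x

module _ (C : ℕ → Bool) {k} a b l c (es : Vec (ℕ × ℕ) k) ℓ (F : Mask ((a , b) ∷ es) (l ∷ ℓ) c) where

  extend-inside : ∀ j → suc j < l →
                  extend C ((a , b) ∷ es) (l ∷ ℓ) c F (c + j)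
                    ≡ segmentLabel (C a) (C b) ∣ maskˡ (path a b l c) F ∣ (prefixCount (suc j) (maskˡ (path a b l c) F))
  extend-inside j j<l
    rewrite dec-true (c ≤? c + j ×-dec c + j <? c + (l ∸ 1)) (m≤m+n c j , +-monoʳ-< c (<⇒≤pred j<l))
          | m+n∸m≡n c j = refl

  extend-after : ∀ {x} → c + (l ∸ 1) ≤ x →
                 extend C ((a , b) ∷ es) (l ∷ ℓ) c F x ≡ extend C es ℓ (c + (l ∸ 1)) (maskʳ (path a b l c) F) x
  extend-after {x} c′≤x
    rewrite dec-false (c ≤? x ×-dec x <? c + (l ∸ 1)) (λ (_ , x<c′) → <⇒≱ x<c′ c′≤x) = refl

extend-below : ∀ C {k} (es : Vec (ℕ × ℕ) k) ℓ c (F : Mask es ℓ c) {x} → x < c → extend C es ℓ c F x ≡ C x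
extend-below C []             []      c F x<c = refl
extend-below C ((a , b) ∷ es) (l ∷ ℓ) c F {x} x<c
  rewrite dec-false (c ≤? x ×-dec x <? c + (l ∸ 1)) (λ (c≤x , _) → <⇒≱ x<c c≤x) =
  extend-below C es ℓ (c + (l ∸ 1)) _ (<-≤-trans x<c (m≤m+n c _))

-- P need only agree with the extension below m and from c on: the later
-- paths touch no other vertex.
extend-closed : ∀ {m} C {k} (es : Vec (ℕ × ℕ) k) ℓ c (F : Mask es ℓ c) (P : ℕ → Bool) →
                All (Below m) es → m ≤ c → (∀ x → x < m → P x ≡ C x) →
                (∀ x → c ≤ x → P x ≡ extend C es ℓ c F x) →
                Closed C (toList es) (support es ℓ c F) → Closed P (subdivision es ℓ c) F
extend-closed C [] [] c F P _ _ _ _ _ ()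
extend-closed C ((a , b) ∷ es) (l ∷ ℓ) c F P ((a<m , b<m) ∷ below) m≤c P≡C P≡extend C-closed =
  Closed-++ (path a b l c) on-path on-rest
  where
  F₁ = maskˡ (path a b l c) F
  R = ∣ F₁ ∣
  on-path : Closed P (path a b l c) F₁
  on-path = path-closed P (segmentLabel (C a) (C b) R) a b l c F₁ (P≡C a a<m)
              (trans (P≡C b b<m) (sym (segmentLabel-end R (λ R≡0 → C-closed (forward (cong (0 <ᵇ_) R≡0))))))
              (λ j j<l → trans (P≡extend (c + j) (m≤m+n c j)) (extend-inside C a b l c es ℓ F j j<l))
  on-rest : Closed P (subdivision es ℓ (c + (l ∸ 1))) (maskʳ (path a b l c) F)
  on-rest = extend-closed C es ℓ (c + (l ∸ 1)) _ P below (≤-trans m≤c (m≤m+n c _)) P≡C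
              (λ x c′≤x → trans (P≡extend x (≤-trans (m≤m+n c _) c′≤x)) (extend-after C a b l c es ℓ F c′≤x))
              (C-closed ∘ later)

first-removed : ∀ {n} (F : Vec Bool n) → 2 ≤ ∣ F ∣ → ∃ λ j → suc j < n × prefixCount (suc j) F ≡ 1
first-removed (false ∷ F) 2≤∣F∣ with first-removed F 2≤∣F∣
... | j , j<n , one = suc j , s≤s j<n , one
first-removed (true ∷ F) (s≤s 1≤∣F∣) = zero , s≤s (≤-trans 1≤∣F∣ (∣p∣≤n F)) , refl

crowded-inner-vertex : ∀ {k} (es : Vec (ℕ × ℕ) k) ℓ c (F : Mask es ℓ c) → ¬ T (atMostOnePerPath es ℓ c F) →
                       ∃ λ x → c ≤ x × x < c + internalCount es ℓ × T (extend (λ _ → false) es ℓ c F x)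
crowded-inner-vertex []             []      c F crowded = contradiction _ crowded
crowded-inner-vertex ((a , b) ∷ es) (l ∷ ℓ) c F crowded with ∣ maskˡ (path a b l c) F ∣ ≤? 1
... | no ∣F₁∣≰1 =
  let j , j<len , one = first-removed (maskˡ (path a b l c) F) (≰⇒> ∣F₁∣≰1)
      j<l = subst (suc j <_) (length-path a b l c) j<len
  in c + j , m≤m+n c j , +-monoʳ-< c (<-≤-trans (<⇒≤pred j<l) (m≤m+n _ _)) ,
     subst T (sym (trans (extend-inside (λ _ → false) a b l c es ℓ F j j<l)
                         (cong (segmentLabel false false ∣ maskˡ (path a b l c) F ∣) one)))
             (segmentLabel-inner {false} {false} (≰⇒> ∣F₁∣≰1))
... | yes ∣F₁∣≤1 =
  let x , c′≤x , x<end , inner = crowded-inner-vertex es ℓ (c + (l ∸ 1)) (maskʳ (path a b l c) F)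
                                   (λ sparse → crowded (Equivalence.from T-∧ (≤⇒≤ᵇ ∣F₁∣≤1 , sparse)))
  in x , ≤-trans (m≤m+n c _) c′≤x , subst (x <_) (+-assoc c (l ∸ 1) _) x<end ,
     subst T (sym (extend-after (λ _ → false) a b l c es ℓ F c′≤x)) inner

subdivide : ∀ {k} → ℕ → Vec (ℕ × ℕ) k → Vec ℕ k → Graph
subdivide m es ℓ = mkGraph (m + internalCount es ℓ) (subdivision es ℓ m)

disconnected : ∀ G {F : Vec Bool (ne G)} {u v} → u < nv G → v < nv G → ¬ Walk (edges G) F u v → Disconnected- G F
disconnected G u<n v<n no-walk =
  fromℕ< u<n , fromℕ< v<n ,
  λ reach → no-walk (subst₂ (Walk _ _) (toℕ-fromℕ< u<n) (toℕ-fromℕ< v<n) (Equivalence.to (Reach⇔Walk G) reach))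

module _ {m k} (es : Vec (ℕ × ℕ) k) (ℓ : Vec ℕ k) (F : Mask es ℓ m) (below : All (Below m) es) where

  connected-subdivision : All (0 <_) ℓ → T (atMostOnePerPath es ℓ m F) →
                          (∀ o → o < m → Walk (toList es) (support es ℓ m F) o 0) →
                          ¬ Disconnected- (subdivide m es ℓ) F
  connected-subdivision positive sparse base-connected (u , v , no-reach) =
    no-reach (Equivalence.from (Reach⇔Walk (subdivide m es ℓ))
               (to-root (toℕ u) (toℕ<n u) ◅◅ Walk-sym (to-root (toℕ v) (toℕ<n v))))
    where
    to-root : ∀ x → x < m + internalCount es ℓ → Walk (subdivision es ℓ m) F x 0
    to-root x x<n with x <? m
    ... | yes x<m = Walk-lift es m positive (base-connected x x<m)
    ... | no x≮m with internal-reaches-base es ℓ m F below sparse (≮⇒≥ x≮m) x<n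
    ...   | o , o<m , x-to-o = x-to-o ◅◅ Walk-lift es m positive (base-connected o o<m)

  extension-separates : ∀ C → Closed C (toList es) (support es ℓ m F) →
                        ∀ {u v} → u < m + internalCount es ℓ → v < m + internalCount es ℓ →
                        extend C es ℓ m F u ≢ extend C es ℓ m F v → Disconnected- (subdivide m es ℓ) F
  extension-separates C C-closed u<n v<n labels-differ =
    disconnected (subdivide m es ℓ) u<n v<n
      (labels-differ ∘ Walk-preserves (extend-closed C es ℓ m F (extend C es ℓ m F) below ≤-refl
                                         (λ x x<m → extend-below C es ℓ m F x<m) (λ _ _ → refl) C-closed))

  crowded-disconnected : 0 < m → ¬ T (atMostOnePerPath es ℓ m F) → Disconnected- (subdivide m es ℓ) F
  crowded-disconnected 0<m crowded with crowded-inner-vertex es ℓ m F crowded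
  ... | x , _ , x<n , inner =
    extension-separates (λ _ → false) (λ _ → refl) (<-≤-trans 0<m (m≤m+n m _)) x<n
      (λ P0≡Px → subst T (trans (sym P0≡Px) (extend-below (λ _ → false) es ℓ m F 0<m)) inner)

length-subdivision : ∀ {k} (es : Vec (ℕ × ℕ) k) ℓ c → length (subdivision es ℓ c) ≡ sum ℓ
length-subdivision []             []      c = refl
length-subdivision ((a , b) ∷ es) (l ∷ ℓ) c =
  trans (length-++ (path a b l c)) (cong₂ _+_ (length-path a b l c) (length-subdivision es ℓ (c + (l ∸ 1))))

∣∣-support : ∀ {k} (es : Vec (ℕ × ℕ) k) ℓ c (F : Mask es ℓ c) → T (atMostOnePerPath es ℓ c F) →
             ∣ F ∣ ≡ ∣ support es ℓ c F ∣
∣∣-support []             []      c [] _      = refl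
∣∣-support ((a , b) ∷ es) (l ∷ ℓ) c F  sparse =
  let ∣F₁∣≤1 , sparse′ = Equivalence.to T-∧ sparse in
  trans (∣∣-++ (path a b l c) F)
        (trans (cong (∣ maskˡ (path a b l c) F ∣ +_) (∣∣-support es ℓ (c + (l ∸ 1)) _ sparse′))
               (first-edge {S = support es ℓ (c + (l ∸ 1)) (maskʳ (path a b l c) F)}
                           (≤ᵇ⇒≤ ∣ maskˡ (path a b l c) F ∣ 1 ∣F₁∣≤1)))
  where
  first-edge : ∀ {n m} {S : Vec Bool m} → n ≤ 1 → n + ∣ S ∣ ≡ ∣ (0 <ᵇ n) ∷ S ∣
  first-edge z≤n       = refl
  first-edge (s≤s z≤n) = refl

-- Σ of ∏_{i ∈ S} ℓ i over the S ⊆ {0, …, k-1} with Q S.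
weightedCount : ∀ {k} → Vec ℕ k → (Vec Bool k → Bool) → ℕ
weightedCount []      Q = if Q [] then 1 else 0
weightedCount (l ∷ ℓ) Q = l * weightedCount ℓ (Q ∘ (true ∷_)) + weightedCount ℓ (Q ∘ (false ∷_))

-- Each path contributes either nothing or one of its l edges.
count-atMostOnePerPath : ∀ {k} (es : Vec (ℕ × ℕ) k) ℓ c (Q : Vec Bool k → Bool) →
                         count (length (subdivision es ℓ c)) (λ F → atMostOnePerPath es ℓ c F ∧ Q (support es ℓ c F))
                           ≡ weightedCount ℓ Q
count-atMostOnePerPath []             []      c Q = refl
count-atMostOnePerPath ((a , b) ∷ es) (l ∷ ℓ) c Q = begin
  count N (λ F → ((size F ≤ᵇ 1) ∧ sparse (rest F)) ∧ Q ((0 <ᵇ size F) ∷ support es ℓ c′ (rest F)))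
    ≡⟨ count-cong N (λ F → by-size (size F) (sparse (rest F)) (λ x → Q (x ∷ support es ℓ c′ (rest F)))) ⟩
  count N (λ F → ((size F ≡ᵇ 1) ∧ Qₜ (rest F)) ∨ ((size F ≡ᵇ 0) ∧ Q𝒻 (rest F)))
    ≡⟨ count-∨ N (λ F → disjoint (size F) (Qₜ (rest F)) (Q𝒻 (rest F))) ⟩
  count N (λ F → (size F ≡ᵇ 1) ∧ Qₜ (rest F)) + count N (λ F → (size F ≡ᵇ 0) ∧ Q𝒻 (rest F))
    ≡⟨ cong₂ _+_ (count-++ p rs (λ F₁ → ∣ F₁ ∣ ≡ᵇ 1) Qₜ) (count-++ p rs (λ F₁ → ∣ F₁ ∣ ≡ᵇ 0) Q𝒻) ⟩
  count (length p) (λ F₁ → ∣ F₁ ∣ ≡ᵇ 1) * count (length rs) Qₜ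
    + count (length p) (λ F₁ → ∣ F₁ ∣ ≡ᵇ 0) * count (length rs) Q𝒻
    ≡⟨ cong₂ _+_ (cong₂ _*_ (trans (count-single (length p)) (length-path a b l c))
                            (count-atMostOnePerPath es ℓ c′ (Q ∘ (true ∷_))))
                 (trans (cong₂ _*_ (count-none (length p)) (count-atMostOnePerPath es ℓ c′ (Q ∘ (false ∷_))))
                        (+-identityʳ _)) ⟩
  l * weightedCount ℓ (Q ∘ (true ∷_)) + weightedCount ℓ (Q ∘ (false ∷_)) ∎
  where
  open ≡-Reasoning
  p = path a b l c
  c′ = c + (l ∸ 1)
  rs = subdivision es ℓ c′
  N = length (p ++ rs)
  size = λ (F : Vec Bool N) → ∣ maskˡ p F ∣
  rest = maskʳ p {rs}
  sparse = atMostOnePerPath es ℓ c′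
  Qₜ = λ F₂ → sparse F₂ ∧ Q (true ∷ support es ℓ c′ F₂)
  Q𝒻 = λ F₂ → sparse F₂ ∧ Q (false ∷ support es ℓ c′ F₂)
  by-size : ∀ n x (q : Bool → Bool) →
            ((n ≤ᵇ 1) ∧ x) ∧ q (0 <ᵇ n) ≡ ((n ≡ᵇ 1) ∧ (x ∧ q true)) ∨ ((n ≡ᵇ 0) ∧ (x ∧ q false))
  by-size zero          x q = refl
  by-size (suc zero)    x q = sym (∨-identityʳ _)
  by-size (suc (suc n)) x q = refl
  disjoint : ∀ n x y → ((n ≡ᵇ 1) ∧ x) ∧ ((n ≡ᵇ 0) ∧ y) ≡ false
  disjoint zero          x y = refl
  disjoint (suc zero)    x y = ∧-zeroʳ x
  disjoint (suc (suc n)) x y = refl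

-- Reachability by repeated sweeps

marked : List Bool → ℕ → Bool
marked []      _       = false
marked (r ∷ R) zero    = r
marked (r ∷ R) (suc v) = marked R v

mark : List Bool → ℕ → List Bool
mark []      zero    = true ∷ []
mark []      (suc v) = false ∷ mark [] v
mark (_ ∷ R) zero    = true ∷ R
mark (r ∷ R) (suc v) = r ∷ mark R v

marked-mark : ∀ R a v → T (marked (mark R a) v) → v ≡ a ⊎ T (marked R v)
marked-mark []      zero    zero    _ = inj₁ refl
marked-mark []      (suc a) (suc v) m with marked-mark [] a v m
... | inj₁ v≡a = inj₁ (cong suc v≡a)
marked-mark (_ ∷ R) zero    zero    _ = inj₁ refl
marked-mark (_ ∷ R) zero    (suc v) m = inj₂ m
marked-mark (_ ∷ R) (suc a) zero    m = inj₂ m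
marked-mark (_ ∷ R) (suc a) (suc v) m with marked-mark R a v m
... | inj₁ v≡a = inj₁ (cong suc v≡a)
... | inj₂ m′  = inj₂ m′

relax : List Bool → ℕ × ℕ → List Bool
relax R (a , b) = if marked R a ∨ marked R b then mark (mark R a) b else R

sweep : List (ℕ × ℕ) → ∀ {n} → Vec Bool n → List Bool → List Bool
sweep (e ∷ es) (false ∷ S) R = sweep es S (relax R e)
sweep (e ∷ es) (true ∷ S)  R = sweep es S R
sweep _        _           R = R

sweeps : ℕ → List (ℕ × ℕ) → ∀ {n} → Vec Bool n → List Bool → List Bool
sweeps zero    es S R = R
sweeps (suc i) es S R = sweeps i es S (sweep es S R)

reached : ℕ → List (ℕ × ℕ) → ∀ {n} → Vec Bool n → List Bool
reached rounds es S = sweeps rounds es S (true ∷ [])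

module _ {es : List (ℕ × ℕ)} {n} {S : Vec Bool n} where

  Rooted : List Bool → Set
  Rooted R = ∀ v → T (marked R v) → Walk es S 0 v

  mark-rooted : ∀ {R a} → Walk es S 0 a → Rooted R → Rooted (mark R a)
  mark-rooted {R} {a} to-a rooted v m with marked-mark R a v m
  ... | inj₁ refl = to-a
  ... | inj₂ m′   = rooted v m′

  relax-rooted : ∀ {R a b} → Link es S a b → Rooted R → Rooted (relax R (a , b))
  relax-rooted {R} {a} {b} link rooted with marked R a in ma | marked R b in mb
  ... | true | _ = mark-rooted {mark R a} (to-a ◅◅ link ◅ ε) (mark-rooted {R} to-a rooted)
    where to-a = rooted a (subst T (sym ma) _)
  ... | false | true = mark-rooted {mark R a} to-b (mark-rooted {R} (to-b ◅◅ Link-sym link ◅ ε) rooted)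
    where to-b = rooted b (subst T (sym mb) _)
  ... | false | false = rooted

  sweep-rooted : ∀ {es′ n′} {S′ : Vec Bool n′} → (∀ {u v} → Link es′ S′ u v → Link es S u v) →
                 ∀ {R} → Rooted R → Rooted (sweep es′ S′ R)
  sweep-rooted {e ∷ es′} {S′ = false ∷ S′} embed {R} rooted =
    sweep-rooted (embed ∘ later) (relax-rooted {R} (embed (forward refl)) rooted)
  sweep-rooted {e ∷ es′} {S′ = true ∷ S′}  embed rooted = sweep-rooted (embed ∘ later) rooted
  sweep-rooted {[]}                         embed rooted = rooted
  sweep-rooted {_ ∷ _}   {S′ = []}          embed rooted = rooted

  sweeps-rooted : ∀ i {R} → Rooted R → Rooted (sweeps i es S R)
  sweeps-rooted zero    rooted = rooted
  sweeps-rooted (suc i) rooted = sweeps-rooted i (sweep-rooted (λ link → link) rooted)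

  reached-rooted : ∀ rounds → Rooted (reached rounds es S)
  reached-rooted rounds = sweeps-rooted rounds λ { zero _ → ε ; (suc _) () }

closed? : List Bool → List (ℕ × ℕ) → ∀ {n} → Vec Bool n → Bool
closed? R ((a , b) ∷ es) (r ∷ S) = (r ∨ isYes (marked R a Bool.≟ marked R b)) ∧ closed? R es S
closed? R _              _       = true

closed?-sound : ∀ R es {n} (S : Vec Bool n) → T (closed? R es S) → Closed (marked R) es S
closed?-sound R ((a , b) ∷ es) (r ∷ S) closed
  with Equivalence.to (T-∧ {r ∨ isYes (marked R a Bool.≟ marked R b)}) closed
... | kept-ok , rest-ok = λ where
  (forward refl)  → toWitness {a? = marked R a Bool.≟ marked R b} kept-ok
  (backward refl) → sym (toWitness {a? = marked R a Bool.≟ marked R b} kept-ok)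
  (later link)    → closed?-sound R es S rest-ok link

-- 5-edge-cuts of subdivisions of W

wagner : List (ℕ × ℕ)
wagner = toList wagnerEdges

reachedW : Vec Bool 12 → List Bool
reachedW = reached 8 wagner

reachedW-certified : ∀ S → T (marked (reachedW S) 0 ∧ closed? (reachedW S) wagner S)
reachedW-certified S = decidable-stable (T? _) λ ¬ok →
  toWitnessFalse {a? = anySubset? λ S → ¬? (T? (marked (reachedW S) 0 ∧ closed? (reachedW S) wagner S))} _ (S , ¬ok)

wagnerConnected? : Vec Bool 12 → Bool
wagnerConnected? S = isYes (all? λ (v : Fin 8) → T? (marked (reachedW S) (toℕ v)))

wagnerConnected?-sound : ∀ S → T (wagnerConnected? S) → ∀ o → o < 8 → Walk wagner S o 0
wagnerConnected?-sound S conn o o<8 =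
  Walk-sym (reached-rooted 8 o (subst (T ∘ marked (reachedW S)) (toℕ-fromℕ< o<8) (toWitness conn (fromℕ< o<8))))

wagner-below : All (Below 8) wagnerEdges
wagner-below = from-yes (All.all? (λ (a , b) → a <? 8 ×-dec b <? 8) wagnerEdges)

connected? : ∀ ℓ → Subset (ne (W ℓ)) → Bool
connected? ℓ F = atMostOnePerPath wagnerEdges ℓ 8 F ∧ wagnerConnected? (support wagnerEdges ℓ 8 F)

Disconnected⇔¬connected : ∀ {ℓ} → All (0 <_) ℓ → ∀ F → Disconnected- (W ℓ) F ⇔ (¬ T (connected? ℓ F))
Disconnected⇔¬connected {ℓ} positive F = mk⇔ to from
  where
  S = support wagnerEdges ℓ 8 F
  C = marked (reachedW S)
  to : Disconnected- (W ℓ) F → ¬ T (connected? ℓ F)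
  to disconnected conn =
    connected-subdivision wagnerEdges ℓ F wagner-below positive (proj₁ (Equivalence.to T-∧ conn))
      (wagnerConnected?-sound S (proj₂ (Equivalence.to T-∧ conn))) disconnected
  separated : ∀ v → v < 8 → ¬ T (C v) → Disconnected- (W ℓ) F
  separated v v<8 unmarked =
    extension-separates wagnerEdges ℓ F wagner-below C (closed?-sound (reachedW S) wagner S (proj₂ certificate))
      (<-≤-trans v<8 (m≤m+n 8 _)) (<-≤-trans z<s (m≤m+n 8 _))
      (λ Pv≡P0 → unmarked (subst T (sym (trans (sym (extend-below C wagnerEdges ℓ 8 F v<8))
                                          (trans Pv≡P0 (extend-below C wagnerEdges ℓ 8 F z<s))))
                                   (proj₁ certificate)))
    where certificate = Equivalence.to T-∧ (reachedW-certified S)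
  from : ¬ T (connected? ℓ F) → Disconnected- (W ℓ) F
  from ¬conn = case T? (atMostOnePerPath wagnerEdges ℓ 8 F) of λ where
    (no crowded) → crowded-disconnected wagnerEdges ℓ F wagner-below z<s crowded
    (yes sparse) →
      let v , unmarked = ¬∀⟶∃¬ 8 (T ∘ C ∘ toℕ) (T? ∘ C ∘ toℕ)
                           (λ all-marked → ¬conn (Equivalence.from T-∧
                                             (sparse , fromWitness {a? = all? (T? ∘ C ∘ toℕ)} all-marked)))
      in separated (toℕ v) (toℕ<n v) unmarked

cut? : ∀ ℓ → Subset (ne (W ℓ)) → Bool
cut? ℓ F = (∣ F ∣ ≡ᵇ 5) ∧ not (connected? ℓ F)

cut?⇔IsEdgeCut : ∀ {ℓ} → All (0 <_) ℓ → ∀ F → T (cut? ℓ F) ⇔ IsEdgeCut 5 (W ℓ) F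
cut?⇔IsEdgeCut {ℓ} positive F = mk⇔ to from
  where
  T-not : ∀ {b} → T (not b) → ¬ T b
  T-not {false} _ ()
  not-T : ∀ {b} → ¬ T b → T (not b)
  not-T {false} _ = _
  not-T {true}  ¬b = ¬b _
  to : T (cut? ℓ F) → IsEdgeCut 5 (W ℓ) F
  to cut = let five , disconnected = Equivalence.to T-∧ cut in
           ≡ᵇ⇒≡ ∣ F ∣ 5 five , Equivalence.from (Disconnected⇔¬connected positive F) (T-not disconnected)
  from : IsEdgeCut 5 (W ℓ) F → T (cut? ℓ F)
  from (five , disconnected) =
    Equivalence.from T-∧
      (≡⇒≡ᵇ ∣ F ∣ 5 five , not-T (Equivalence.to (Disconnected⇔¬connected positive F) disconnected))

mu₅ : ∀ {ℓ} → All (0 <_) ℓ → IsMu 5 (W ℓ) (count (ne (W ℓ)) (cut? ℓ))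
mu₅ {ℓ} positive = Enumerates-⇔ (cut?⇔IsEdgeCut positive) (enumerate (ne (W ℓ)) (cut? ℓ))

nonCut? : Vec Bool 12 → Bool
nonCut? S = (∣ S ∣ ≡ᵇ 5) ∧ wagnerConnected? S

cuts+nonCuts : ∀ {ℓ} → All (0 <_) ℓ →
               count (ne (W ℓ)) (cut? ℓ) + weightedCount ℓ nonCut? ≡ count (ne (W ℓ)) (λ F → ∣ F ∣ ≡ᵇ 5)
cuts+nonCuts {ℓ} positive = begin
  count N (cut? ℓ) + weightedCount ℓ nonCut?
    ≡⟨ cong (count N (cut? ℓ) +_)
            (sym (trans (count-cong N same-test) (count-atMostOnePerPath wagnerEdges ℓ 8 nonCut?))) ⟩
  count N (cut? ℓ) + count N (λ F → (∣ F ∣ ≡ᵇ 5) ∧ connected? ℓ F)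
    ≡⟨ +-comm (count N (cut? ℓ)) _ ⟩
  count N (λ F → (∣ F ∣ ≡ᵇ 5) ∧ connected? ℓ F) + count N (cut? ℓ)
    ≡⟨ count-∧-not N (λ F → ∣ F ∣ ≡ᵇ 5) (connected? ℓ) ⟩
  count N (λ F → ∣ F ∣ ≡ᵇ 5) ∎
  where
  open ≡-Reasoning
  N = ne (W ℓ)
  same-test : ∀ F → (∣ F ∣ ≡ᵇ 5) ∧ connected? ℓ F
                      ≡ atMostOnePerPath wagnerEdges ℓ 8 F ∧ nonCut? (support wagnerEdges ℓ 8 F)
  same-test F = rearrange (atMostOnePerPath wagnerEdges ℓ 8 F) (∣∣-support wagnerEdges ℓ 8 F)
    where
    rearrange : ∀ {m n x} a → (T a → m ≡ n) → (m ≡ᵇ 5) ∧ (a ∧ x) ≡ a ∧ ((n ≡ᵇ 5) ∧ x)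
    rearrange {x = x} true  m≡n = cong (λ k → (k ≡ᵇ 5) ∧ x) (m≡n _)
    rearrange         false _   = ∧-zeroʳ _

FewerFiveCuts : Vec ℕ 12 → Vec ℕ 12 → Set
FewerFiveCuts ℓ′ ℓ = Σ ℕ λ a → Σ ℕ λ b → IsMu 5 (W ℓ′) a × IsMu 5 (W ℓ) b × a < b

fewer-cuts : ∀ {ℓ ℓ′} → All (0 <_) ℓ → All (0 <_) ℓ′ → sum ℓ ≡ sum ℓ′ →
             weightedCount ℓ nonCut? < weightedCount ℓ′ nonCut? → FewerFiveCuts ℓ′ ℓ
fewer-cuts {ℓ} {ℓ′} positive positive′ same-size more-nonCuts =
  _ , _ , mu₅ positive′ , mu₅ positive ,
  +-cancelʳ-< (weightedCount ℓ′ nonCut?) _ _ (begin-strict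
    count (ne (W ℓ′)) (cut? ℓ′) + weightedCount ℓ′ nonCut? ≡⟨ cuts+nonCuts positive′ ⟩
    count (ne (W ℓ′)) five                                 ≡⟨ cong (λ N → count N five) same-edges ⟨
    count (ne (W ℓ)) five                                  ≡⟨ cuts+nonCuts positive ⟨
    count (ne (W ℓ)) (cut? ℓ) + weightedCount ℓ nonCut?    <⟨ +-monoʳ-< _ more-nonCuts ⟩
    count (ne (W ℓ)) (cut? ℓ) + weightedCount ℓ′ nonCut?   ∎)
  where
  open ≤-Reasoning
  five : ∀ {N} → Vec Bool N → Bool
  five F = ∣ F ∣ ≡ᵇ 5
  same-edges : ne (W ℓ) ≡ ne (W ℓ′)
  same-edges =
    trans (length-subdivision wagnerEdges ℓ 8) (trans same-size (sym (length-subdivision wagnerEdges ℓ′ 8)))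

-- Weighted counts as polynomials in the common length

Poly : Set
Poly = List ℕ

⟦_⟧ : Poly → ℕ → ℕ
⟦ []    ⟧ t = 0
⟦ a ∷ p ⟧ t = a + t * ⟦ p ⟧ t

_⊕_ : Poly → Poly → Poly
[]      ⊕ q       = q
(a ∷ p) ⊕ []      = a ∷ p
(a ∷ p) ⊕ (b ∷ q) = a + b ∷ p ⊕ q

⟦⊕⟧ : ∀ p q t → ⟦ p ⊕ q ⟧ t ≡ ⟦ p ⟧ t + ⟦ q ⟧ t
⟦⊕⟧ []      q       t = refl
⟦⊕⟧ (a ∷ p) []      t = sym (+-identityʳ _)
⟦⊕⟧ (a ∷ p) (b ∷ q) t rewrite ⟦⊕⟧ p q t | *-distribˡ-+ t (⟦ p ⟧ t) (⟦ q ⟧ t) =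
  interchange +-commutativeSemigroup a b (t * ⟦ p ⟧ t) (t * ⟦ q ⟧ t)

linear· : ℕ → Poly → Poly
linear· c []      = []
linear· c (a ∷ p) = c * a ∷ (a ∷ []) ⊕ linear· c p

⟦linear·⟧ : ∀ c p t → ⟦ linear· c p ⟧ t ≡ (c + t) * ⟦ p ⟧ t
⟦linear·⟧ c []      t = sym (*-zeroʳ (c + t))
⟦linear·⟧ c (a ∷ p) t rewrite ⟦⊕⟧ (a ∷ []) (linear· c p) t | ⟦linear·⟧ c p t = expand c a t (⟦ p ⟧ t)
  where
  expand : ∀ c a t x → c * a + t * ((a + t * 0) + (c + t) * x) ≡ (c + t) * (a + t * x)
  expand = solve-∀

data TruthTable : ℕ → Set where
  leaf : Bool → TruthTable zero
  node : ∀ {k} → TruthTable k → TruthTable k → TruthTable (suc k)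

table : ∀ {k} → (Vec Bool k → Bool) → TruthTable k
table {zero}  Q = leaf (Q [])
table {suc k} Q = node (table (Q ∘ (true ∷_))) (table (Q ∘ (false ∷_)))

weightedPoly : ∀ {k} → Vec ℕ k → TruthTable k → Poly
weightedPoly []       (leaf b)     = if b then 1 ∷ [] else []
weightedPoly (c ∷ cs) (node Qₜ Q𝒻) = linear· c (weightedPoly cs Qₜ) ⊕ weightedPoly cs Q𝒻

⟦weightedPoly⟧ : ∀ {k} (cs : Vec ℕ k) Q t → ⟦ weightedPoly cs (table Q) ⟧ t ≡ weightedCount (map (_+ t) cs) Q
⟦weightedPoly⟧ []       Q t with Q []
... | true  = cong suc (*-zeroʳ t)
... | false = refl
⟦weightedPoly⟧ (c ∷ cs) Q t
  rewrite ⟦⊕⟧ (linear· c (weightedPoly cs (table (Q ∘ (true ∷_))))) (weightedPoly cs (table (Q ∘ (false ∷_)))) t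
        | ⟦linear·⟧ c (weightedPoly cs (table (Q ∘ (true ∷_)))) t
        | ⟦weightedPoly⟧ cs (Q ∘ (true ∷_)) t
        | ⟦weightedPoly⟧ cs (Q ∘ (false ∷_)) t = refl

⟦⟧-mono-≤ : ∀ {p q} t → Pointwise _≤_ p q → ⟦ p ⟧ t ≤ ⟦ q ⟧ t
⟦⟧-mono-≤ t []            = z≤n
⟦⟧-mono-≤ t (a≤b ∷ p≤q) = +-mono-≤ a≤b (*-monoʳ-≤ t (⟦⟧-mono-≤ t p≤q))

data Dominated : Poly → Poly → Set where
  dominated : ∀ {a b p q} → a < b → Pointwise _≤_ p q → Dominated (a ∷ p) (b ∷ q)

dominated? : ∀ p q → Dec (Dominated p q)
dominated? (a ∷ p) (b ∷ q) =
  Dec.map′ (λ (a<b , p≤q) → dominated a<b p≤q) (λ { (dominated a<b p≤q) → a<b , p≤q })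
           (a <? b ×-dec decidable _≤?_ p q)
dominated? []      _       = no λ ()
dominated? (_ ∷ _) []      = no λ ()

⟦⟧-mono-< : ∀ {p q} t → Dominated p q → ⟦ p ⟧ t < ⟦ q ⟧ t
⟦⟧-mono-< t (dominated a<b p≤q) = +-mono-<-≤ a<b (*-monoʳ-≤ t (⟦⟧-mono-≤ t p≤q))

weightedCount-< : ∀ {k} (cs cs′ : Vec ℕ k) Q t → Dominated (weightedPoly cs (table Q)) (weightedPoly cs′ (table Q)) →
                  weightedCount (map (_+ t) cs) Q < weightedCount (map (_+ t) cs′) Q
weightedCount-< cs cs′ Q t p≺q =
  subst₂ _<_ (⟦weightedPoly⟧ cs Q t) (⟦weightedPoly⟧ cs′ Q t) (⟦⟧-mono-< t p≺q)

-- G_n and H_n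

lengthsG : ℕ → ℕ → Vec ℕ 12
lengthsG r s = tabulate λ j → if inX r (toℕ j) then suc s else s

lengthsH : ℕ → ℕ → Vec ℕ 12
lengthsH r s = updateAt (updateAt (lengthsG r s) (# 4) (_∸ 1)) (# 0) suc

lengthsG-shift : ∀ r s t → lengthsG r (s + t) ≡ map (_+ t) (lengthsG r s)
lengthsG-shift r s t =
  trans (tabulate-cong (shift-if ∘ inX r ∘ toℕ)) (tabulate-∘ (_+ t) (λ j → if inX r (toℕ j) then suc s else s))
  where
  shift-if : ∀ b → (if b then suc (s + t) else s + t) ≡ (if b then suc s else s) + t
  shift-if true  = refl
  shift-if false = refl

lengthsH-shift : ∀ r s t → 1 ≤ s → lengthsH r (s + t) ≡ map (_+ t) (lengthsH r s)
lengthsH-shift r s t 1≤s = begin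
  updateAt (updateAt (lengthsG r (s + t)) (# 4) (_∸ 1)) (# 0) suc
    ≡⟨ cong (λ v → updateAt (updateAt v (# 4) (_∸ 1)) (# 0) suc) (lengthsG-shift r s t) ⟩
  updateAt (updateAt (map (_+ t) (lengthsG r s)) (# 4) (_∸ 1)) (# 0) suc
    ≡⟨ cong (λ v → updateAt v (# 0) suc)
            (map-updateAt {f = _+ t} {g = _∸ 1} {h = _∸ 1} (lengthsG r s) (# 4) pred-shift) ⟨
  updateAt (map (_+ t) (updateAt (lengthsG r s) (# 4) (_∸ 1))) (# 0) suc
    ≡⟨ map-updateAt {f = _+ t} {g = suc} {h = suc} (updateAt (lengthsG r s) (# 4) (_∸ 1)) (# 0) refl ⟨
  map (_+ t) (lengthsH r s) ∎
  where
  open ≡-Reasoning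
  ℓ₅ = lookup (lengthsG r s) (# 4)
  1≤ℓ₅ : 1 ≤ ℓ₅
  1≤ℓ₅ with inX r 4
  ... | true  = s≤s z≤n
  ... | false = 1≤s
  pred-shift : (ℓ₅ ∸ 1) + t ≡ (ℓ₅ + t) ∸ 1
  pred-shift = sym (+-∸-comm t 1≤ℓ₅)

sum-map-+ : ∀ {k} (cs : Vec ℕ k) t → sum (map (_+ t) cs) ≡ sum cs + k * t
sum-map-+ []               t = refl
sum-map-+ {suc k} (c ∷ cs) t rewrite sum-map-+ cs t = interchange +-commutativeSemigroup c t (sum cs) (k * t)

shift-positive : ∀ {k} (cs : Vec ℕ k) t → All (0 <_) cs → All (0 <_) (map (_+ t) cs)
shift-positive cs t = map⁺ ∘ All.map (λ 0<c → <-≤-trans 0<c (m≤m+n _ t))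

shift-same-sum : ∀ {k} (cs cs′ : Vec ℕ k) t → sum cs ≡ sum cs′ → sum (map (_+ t) cs) ≡ sum (map (_+ t) cs′)
shift-same-sum {k} cs cs′ t same-sum =
  trans (sum-map-+ cs t) (trans (cong (_+ k * t) same-sum) (sym (sum-map-+ cs′ t)))

-- 15 is the least s for which the comparison is coefficientwise in every residue class.
ResidueFacts : TruthTable 12 → ℕ → Set
ResidueFacts Q r =
  All (0 <_) (lengthsG r 15) × All (0 <_) (lengthsH r 15) × sum (lengthsG r 15) ≡ sum (lengthsH r 15) ×
  Dominated (weightedPoly (lengthsG r 15) Q) (weightedPoly (lengthsH r 15) Q)

residueFacts? : ∀ Q r → Dec (ResidueFacts Q r)
residueFacts? Q r =
  All.all? (0 <?_) (lengthsG r 15) ×-dec All.all? (0 <?_) (lengthsH r 15) ×-dec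
  sum (lengthsG r 15) ≟ sum (lengthsH r 15) ×-dec
  dominated? (weightedPoly (lengthsG r 15) Q) (weightedPoly (lengthsH r 15) Q)

-- Taking the table as an argument lets all 24 polynomials share one evaluation of
-- nonCut? on the 4096 subsets of E(W).
residues? : ∀ Q → Dec (∀ (r : Fin 12) → ResidueFacts Q (toℕ r))
residues? Q = all? (residueFacts? Q ∘ toℕ)

all-residues : ∀ (r : Fin 12) → ResidueFacts (table nonCut?) (toℕ r)
all-residues = from-yes (residues? (table nonCut?))

residue-comparison : ∀ r → r < 12 → ∀ t → FewerFiveCuts (lengthsH r (15 + t)) (lengthsG r (15 + t))
residue-comparison r r<12 t =
  compare (subst (ResidueFacts (table nonCut?)) (toℕ-fromℕ< r<12) (all-residues (fromℕ< r<12)))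
  where
  compare : ResidueFacts (table nonCut?) r → FewerFiveCuts (lengthsH r (15 + t)) (lengthsG r (15 + t))
  compare (positiveG , positiveH , same-sum , p≺q) =
    subst₂ FewerFiveCuts (sym (lengthsH-shift r 15 t (s≤s z≤n))) (sym (lengthsG-shift r 15 t))
      (fewer-cuts (shift-positive (lengthsG r 15) t positiveG) (shift-positive (lengthsH r 15) t positiveH)
                  (shift-same-sum (lengthsG r 15) (lengthsH r 15) t same-sum)
                  (weightedCount-< (lengthsG r 15) (lengthsH r 15) nonCut? t p≺q))

proposition3 : Σ ℕ λ n₀ → 1 ≤ n₀ × ((n : ℕ) → n₀ ≤ n → 2 ≤ ℓ5 n →
                 Σ ℕ λ a → Σ ℕ λ b → IsMu 5 (Hn n) a × IsMu 5 (Gn n) b × a < b)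
proposition3 = 176 , s≤s z≤n , λ n 176≤n _ →
  let 15≤s = /-monoˡ-≤ 12 (+-monoˡ-≤ 4 176≤n) in
  subst (λ s → FewerFiveCuts (lengthsH (rOf n) s) (lengthsG (rOf n) s)) (m+[n∸m]≡n 15≤s)
        (residue-comparison (rOf n) (m%n<n (n + 4) 12) (sOf n ∸ 15))
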